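{- For $d\geq 3$, $n\geq 3$, $n'\geq 3$, every homomorphism $f:L(G_{n,d})\to L(G_{n',d})$ maps special nodes of $L(G_{n,d})$ to special nodes of $L(G_{n',d})$.
   Context: For $n\geq 3$, the $n$-sunlet $S_n$ is the graph on $2n$ vertices obtained from the cycle $C_n$ by attaching a pendant edge to each cycle vertex. For $d\geq 3$, the $d$-dragon $D_d$ is obtained from $K_{d+1}$ by subdividing one edge once (so it has exactly one vertex of degree 2). The indicator $I_d(a,b)$ is the disjoint union of $D_d$ and a path $a,c,b$, together with an edge joining $c$ to the degree-2 vertex of $D_d$. The graph $G_{n,d}=S_n*I_d(a,b)$ is obtained from $S_n$ by replacing every edge $\{x,y\}$ of $S_n$ by a fresh copy of $I_d(a,b)$ in which $a$ is identified with $x$ and $b$ with $y$ (copies for distinct edges are otherwise disjoint). $L(G)$ denotes the line graph (vertex set $E_G$, adjacency = sharing an endpoint); its vertices are called nodes. A node of $L(G_{n,d})$ is special if it corresponds to an edge of $G_{n,d}$ joining a vertex $c$ of some copy of the indicator to the degree-2 vertex of the dragon in that copy. A homomorphism is a vertex map sending edges to edges. -}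

module Defs where

open import Data.Nat as ℕ using (ℕ; zero; suc; _≤_; _%_)
open import Data.Nat.DivMod using (m%n<n)
open import Data.Fin as Fin using (Fin; toℕ; fromℕ<)
open import Data.Product using (Σ; ∃; _×_; _,_; proj₁; proj₂)
open import Data.Sum using (_⊎_)
open import Relation.Binary.PropositionalEquality using (_≡_; _≢_)

record Graph : Set₁ where
  field
    V   : Set
    Adj : V → V → Set

IsHom : (G H : Graph) → (Graph.V G → Graph.V H) → Set
IsHom G H f = ∀ {u v} → Graph.Adj G u v → Graph.Adj H (f u) (f v)

-- A (simple) graph presented by an explicit edge set, each edge listed
-- exactly once, together with its two endpoints.
record EdgeGraph : Set₁ where
  field
    V    : Set
    E    : Set
    ends : E → V × V

shareEnd : ∀ {V : Set} → V × V → V × V → Set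
shareEnd (a , b) (c , d) = (a ≡ c) ⊎ (a ≡ d) ⊎ (b ≡ c) ⊎ (b ≡ d)

L : EdgeGraph → Graph
L G = record
  { V   = EdgeGraph.E G
  ; Adj = λ e e' → e ≢ e' × shareEnd (EdgeGraph.ends G e) (EdgeGraph.ends G e')
  }

-- The sunlet S_n : cycle vertices cyc i, pendant vertices pen i (i : Fin n),
-- cycle edges {cyc i, cyc (i+1 mod n)} and pendant edges {cyc i, pen i}.

next : ∀ {n} → Fin n → Fin n
next {suc m} i = fromℕ< (m%n<n (suc (toℕ i)) (suc m))

data SV (n : ℕ) : Set where
  cyc : Fin n → SV n
  pen : Fin n → SV n

data SE (n : ℕ) : Set where
  cycE : Fin n → SE n
  penE : Fin n → SE n

sEnds : ∀ {n} → SE n → SV n × SV n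
sEnds (cycE i) = cyc i , cyc (next i)
sEnds (penE i) = cyc i , pen i

Sunlet : ℕ → EdgeGraph
Sunlet n = record { V = SV n ; E = SE n ; ends = sEnds }

-- G_{n,d} = S_n * I_d(a,b).
-- For every sunlet edge e = {x,y} (with x,y = sEnds e, a ↦ x, b ↦ y) a fresh
-- copy of I_d : vertex c, the dragon D_d on K_{d+1}-vertices Fin (suc d)
-- whose edge {0,1} is subdivided by the degree-2 vertex w.

data GV (n d : ℕ) : Set where
  sv : SV n → GV n d                 -- vertices of S_n (the a's and b's)
  cv : SE n → GV n d
  kv : SE n → Fin (suc d) → GV n d
  wv : SE n → GV n d

data GE (n d : ℕ) : Set where
  acE : SE n → GE n d
  cbE : SE n → GE n d
  cwE : SE n → GE n d
  w0E : SE n → GE n d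
  w1E : SE n → GE n d
  -- edges {i,j} of K_{d+1} with i < j, other than the subdivided edge {0,1}
  -- (for i < j, {i,j} ≠ {0,1} iff 2 ≤ j)
  kkE : SE n → (i j : Fin (suc d)) → toℕ i ℕ.< toℕ j → 2 ≤ toℕ j → GE n d

gEnds : ∀ {n d} → GE n d → GV n d × GV n d
gEnds (acE e) = sv (proj₁ (sEnds e)) , cv e
gEnds (cbE e) = cv e , sv (proj₂ (sEnds e))
gEnds (cwE e) = cv e , wv e
gEnds {d = d} (w0E e) = wv e , kv e Fin.zero
gEnds {d = zero} (w1E e) = wv e , kv e Fin.zero   -- d = 0 never used (d ≥ 3)
gEnds {d = suc d} (w1E e) = wv e , kv e (Fin.suc Fin.zero)
gEnds (kkE e i j _ _) = kv e i , kv e j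

G : ℕ → ℕ → EdgeGraph
G n d = record { V = GV n d ; E = GE n d ; ends = gEnds }

Special : ∀ {n d} → GE n d → Set
Special {n} x = Σ (SE n) λ e → x ≡ cwE e

-- Folding the sunlet S_{n'} onto one vertex with a loop and a pendant edge is a homomorphism
-- L(G_{n',d}) → L(G_{1,d}) that sends only special nodes to special ones, so it suffices to follow one
-- copy of the dragon D_d under a homomorphism g into L(G_{1,d}).
--
-- For d ≥ 4 the d edges at a vertex kᵢ of K_{d+1} form a clique, and a clique of four or more
-- nodes of a line graph is a star; here it must be the star at a vertex of K_{d+1} in the target,
-- the hub of i.  If two hubs coincided, all would, and the far ends of the image edges would
-- colour the edges of D_d properly with d colours, which a parity count of two colour classes rules
-- out.  Hence the hubs are distinct vertices of one copy, g maps the edges of K_{d+1} to the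
-- corresponding edges, the two halves w0, w1 to the two halves, and cw, which meets both halves,
-- to the only other edge at w.
--
-- For d = 3 the target G_{1,3} is finite and the claim is settled by exhaustive search.

module Submission where

open import Defs
open import Data.Nat as ℕ using (ℕ; zero; suc; _+_; _≤_; _<_; z≤n; s≤s; _%_; NonZero)
import Data.Nat.Properties as ℕ
open import Data.Nat.DivMod using (m<n⇒m%n≡m; n%n≡0)
open import Data.Nat.Divisibility using (_∣_; _∣0; ∣-refl; ∣m∣n⇒∣m+n; ∣m+n∣m⇒∣n; ∣1⇒≡1)
open import Data.Fin as Fin using (Fin; toℕ; punchIn; punchOut)
open import Data.Fin.Patterns using (0F; 1F; 2F; 3F)
open import Data.Fin.Properties as Fin using (any?; all?; injective⇒≤; punchInᵢ≢i)
open import Data.Maybe using (Maybe; just; nothing)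
import Data.Maybe.Properties as Maybe
open import Data.Product using (∃; ∃₂; _×_; _,_; proj₁; proj₂; swap)
open import Data.Product.Properties using (≡-dec)
open import Data.Sum using (_⊎_; inj₁; inj₂)
open import Data.Empty using (⊥; ⊥-elim)
open import Function using (_∘_; _on_)
open import Function.Definitions using (Injective)
open import Relation.Nullary using (¬_; ¬?; Dec; yes; no; contradiction)
open import Relation.Nullary.Decidable using (False; toWitnessFalse; map′; _×-dec_; _⊎-dec_; _→-dec_; from-yes)
open import Relation.Unary using (Decidable)
open import Relation.Binary.Definitions using (DecidableEquality; Tri; tri<; tri≈; tri>)
open import Relation.Binary.PropositionalEquality
open ≡-Reasoning

-- Finite combinatorics

injective⇒surjective : ∀ {n} {f : Fin n → Fin n} → Injective _≡_ _≡_ f → ∀ j → ∃ λ i → f i ≡ j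
injective⇒surjective {suc n} {f} f-inj j with any? (λ i → f i Fin.≟ j)
... | yes hit = hit
... | no miss = contradiction (injective⇒≤ h-inj) ℕ.1+n≰n
  where
  h : Fin (suc n) → Fin n
  h i = punchOut (λ j≡fi → miss (i , sym j≡fi))
  h-inj : Injective _≡_ _≡_ h
  h-inj = f-inj ∘ Fin.punchOut-injective {i = j} _ _

injective-into-image⇒≤ : ∀ {A : Set} {m k} {h : Fin m → A} → Injective _≡_ _≡_ h →
                         (v : Fin k → A) → (∀ x → ∃ λ t → h x ≡ v t) → m ≤ k
injective-into-image⇒≤ h-inj v into = injective⇒≤ tag-inj
  where
  tag-inj : Injective _≡_ _≡_ (proj₁ ∘ into)
  tag-inj {x} {y} eq = h-inj (trans (proj₂ (into x)) (trans (cong v eq) (sym (proj₂ (into y)))))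

avoid : ∀ {k N} (v : Fin k → Fin N) → k < N → ∃ λ γ → ∀ t → v t ≢ γ
avoid {k} {N} v k<N with any? (λ γ → all? (λ t → ¬? (v t Fin.≟ γ)))
... | yes found = found
... | no ¬found = contradiction (injective-into-image⇒≤ (λ eq → eq) v preimage) (ℕ.<⇒≱ k<N)
  where
  preimage : ∀ γ → ∃ λ t → γ ≡ v t
  preimage γ with any? (λ t → v t Fin.≟ γ)
  ... | yes (t , vt≡γ) = t , sym vt≡γ
  ... | no none = ⊥-elim (¬found (γ , λ t vt≡γ → none (t , vt≡γ)))

fixedPointFreeInvolution⇒even : ∀ m (p : Fin m → Fin m) → (∀ i → p i ≢ i) → (∀ i → p (p i) ≡ i) →
                                2 ∣ m
fixedPointFreeInvolution⇒even zero p _ _ = 2 ∣0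
fixedPointFreeInvolution⇒even (suc zero) p fixed-free _ with p Fin.zero | fixed-free Fin.zero
... | Fin.zero | p0≢0 = ⊥-elim (p0≢0 refl)
fixedPointFreeInvolution⇒even (suc (suc k)) p fixed-free involutive with p Fin.zero in p0≡
... | Fin.zero = ⊥-elim (fixed-free Fin.zero p0≡)
... | Fin.suc j = ∣m∣n⇒∣m+n ∣-refl (fixedPointFreeInvolution⇒even k q q-fixed-free q-involutive)
  where
  -- Removing 0 and its partner suc j leaves a fixed-point-free involution q on the other k points.
  embed : Fin k → Fin (suc (suc k))
  embed i = Fin.suc (punchIn j i)

  embed-injective : Injective _≡_ _≡_ embed
  embed-injective = Fin.punchIn-injective j _ _ ∘ Fin.suc-injective

  p-embed≢0 : ∀ i → p (embed i) ≢ Fin.zero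
  p-embed≢0 i eq = punchInᵢ≢i j i (Fin.suc-injective (begin
    embed i            ≡⟨ involutive (embed i) ⟨
    p (p (embed i))    ≡⟨ cong p eq ⟩
    p Fin.zero         ≡⟨ p0≡ ⟩
    Fin.suc j          ∎))

  p-embed≢1+j : ∀ i → p (embed i) ≢ Fin.suc j
  p-embed≢1+j i eq = Fin.0≢1+n (begin
    Fin.zero           ≡⟨ involutive Fin.zero ⟨
    p (p Fin.zero)     ≡⟨ cong p (trans p0≡ (sym eq)) ⟩
    p (p (embed i))    ≡⟨ involutive (embed i) ⟩
    embed i            ∎)

  lower : Fin k → Fin (suc k)
  lower i = punchOut (p-embed≢0 i ∘ sym)

  j≢lower : ∀ i → j ≢ lower i
  j≢lower i eq = p-embed≢1+j i (trans (sym (Fin.punchIn-punchOut (p-embed≢0 i ∘ sym))) (cong Fin.suc (sym eq)))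

  q : Fin k → Fin k
  q i = punchOut (j≢lower i)

  embed-q : ∀ i → embed (q i) ≡ p (embed i)
  embed-q i = begin
    Fin.suc (punchIn j (q i))  ≡⟨ cong Fin.suc (Fin.punchIn-punchOut (j≢lower i)) ⟩
    Fin.suc (lower i)          ≡⟨ Fin.punchIn-punchOut (p-embed≢0 i ∘ sym) ⟩
    p (embed i)                ∎

  q-fixed-free : ∀ i → q i ≢ i
  q-fixed-free i eq = fixed-free (embed i) (trans (sym (embed-q i)) (cong embed eq))

  q-involutive : ∀ i → q (q i) ≡ i
  q-involutive i = embed-injective (begin
    embed (q (q i))    ≡⟨ embed-q (q i) ⟩
    p (embed (q i))    ≡⟨ cong p (embed-q i) ⟩
    p (p (embed i))    ≡⟨ involutive (embed i) ⟩
    embed i            ∎)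

-- Edge colourings of the dragon

Subdivided : ∀ {m} → Fin (2 + m) → Fin (2 + m) → Set
Subdivided i j = (i ≡ 0F × j ≡ 1F) ⊎ (i ≡ 1F × j ≡ 0F)

Subdivided? : ∀ {m} (i j : Fin (2 + m)) → Dec (Subdivided i j)
Subdivided? i j = (i Fin.≟ 0F ×-dec j Fin.≟ 1F) ⊎-dec (i Fin.≟ 1F ×-dec j Fin.≟ 0F)

¬Subdivided-2≤ˡ : ∀ {m} {i j : Fin (2 + m)} → 2 ≤ toℕ i → ¬ Subdivided i j
¬Subdivided-2≤ˡ () (inj₁ (refl , _))
¬Subdivided-2≤ˡ (s≤s ()) (inj₂ (refl , _))

¬Subdivided-2≤ʳ : ∀ {m} {i j : Fin (2 + m)} → 2 ≤ toℕ j → ¬ Subdivided i j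
¬Subdivided-2≤ʳ (s≤s ()) (inj₁ (_ , refl))
¬Subdivided-2≤ʳ () (inj₂ (_ , refl))

¬Subdivided-away : ∀ {m} {i j : Fin (2 + m)} → i ≢ 0F → i ≢ 1F → ¬ Subdivided i j
¬Subdivided-away i≢0 _ (inj₁ (i≡0 , _)) = i≢0 i≡0
¬Subdivided-away _ i≢1 (inj₂ (i≡1 , _)) = i≢1 i≡1

Subdivided⇒≢ : ∀ {m} {i j : Fin (2 + m)} → Subdivided i j → i ≢ j
Subdivided⇒≢ (inj₁ (refl , refl)) ()
Subdivided⇒≢ (inj₂ (refl , refl)) ()

Subdivided-sym : ∀ {m} {i j : Fin (2 + m)} → Subdivided i j → Subdivided j i
Subdivided-sym (inj₁ (i≡0 , j≡1)) = inj₂ (j≡1 , i≡0)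
Subdivided-sym (inj₂ (i≡1 , j≡0)) = inj₁ (j≡0 , i≡1)

Subdivided-functional : ∀ {m} {i j j′ : Fin (2 + m)} → Subdivided i j → Subdivided i j′ → j ≡ j′
Subdivided-functional (inj₁ (_ , refl)) (inj₁ (_ , refl)) = refl
Subdivided-functional (inj₂ (_ , refl)) (inj₂ (_ , refl)) = refl
Subdivided-functional (inj₁ (refl , _)) (inj₂ (() , _))
Subdivided-functional (inj₂ (refl , _)) (inj₁ (() , _))

-- A proper edge colouring of the dragon on the points Fin (2 + n), using the colours Fin (2 + n)
-- other than excluded: colour i j is the colour of the edge at i pointing towards j.  At 0 and 1
-- these are the two halves of the subdivided edge, which meet at the degree-2 vertex.
record DragonColouring (n : ℕ) : Set where
  field
    excluded         : Fin (2 + n)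
    colour           : Fin (2 + n) → Fin (2 + n) → Fin (2 + n)
    colour≢excluded  : ∀ i j → i ≢ j → colour i j ≢ excluded
    colour-injective : ∀ i j j′ → i ≢ j → i ≢ j′ → colour i j ≡ colour i j′ → j ≡ j′
    colour-sym       : ∀ i j → i ≢ j → ¬ Subdivided i j → colour i j ≡ colour j i
    colour-halves    : colour 0F 1F ≢ colour 1F 0F

-- The colour classes are perfect matchings: one avoiding both halves of the subdivided edge
-- matches the 2 + n points, the colour of the half at 0 matches them together with the
-- degree-2 vertex.  So 2 + n would be both even and odd.
¬DragonColouring : ∀ {m} → ¬ DragonColouring (2 + m)
¬DragonColouring {m} κ = 2∤1 (∣m+n∣m⇒∣n (subst (2 ∣_) (ℕ.+-comm 1 N) points+w-even) points-even)
  where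
  open DragonColouring κ
  N = 4 + m

  2∤1 : ¬ 2 ∣ 1
  2∤1 2∣1 with ∣1⇒≡1 2∣1
  ... | ()

  partner : ∀ i γ → γ ≢ excluded → ∃ λ j → i ≢ j × colour i j ≡ γ
  partner i γ γ≢excluded with injective⇒surjective {f = h} h-inj (punchOut (γ≢excluded ∘ sym))
    where
    h : Fin (3 + m) → Fin (3 + m)
    h t = punchOut (colour≢excluded i (punchIn i t) (punchInᵢ≢i i t ∘ sym) ∘ sym)
    h-inj : Injective _≡_ _≡_ h
    h-inj {s} {t} eq = Fin.punchIn-injective i s t
      (colour-injective i _ _ (punchInᵢ≢i i s ∘ sym) (punchInᵢ≢i i t ∘ sym)
        (Fin.punchOut-injective {i = excluded} _ _ eq))
  ... | t , ht≡ = punchIn i t , punchInᵢ≢i i t ∘ sym , Fin.punchOut-injective {i = excluded} _ _ ht≡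

  colour-class-even : ∀ γ → γ ≢ excluded → (∀ i j → Subdivided i j → colour i j ≢ γ) → 2 ∣ N
  colour-class-even γ γ≢excluded avoids = fixedPointFreeInvolution⇒even N p fixed-free involutive
    where
    p : Fin N → Fin N
    p i = proj₁ (partner i γ γ≢excluded)
    fixed-free : ∀ i → p i ≢ i
    fixed-free i eq = proj₁ (proj₂ (partner i γ γ≢excluded)) (sym eq)
    colour-p : ∀ i → colour i (p i) ≡ γ
    colour-p i = proj₂ (proj₂ (partner i γ γ≢excluded))
    involutive : ∀ i → p (p i) ≡ i
    involutive i = colour-injective (p i) (p (p i)) i (fixed-free (p i) ∘ sym) (fixed-free i)
      (begin
        colour (p i) (p (p i))  ≡⟨ colour-p (p i) ⟩
        γ                       ≡⟨ colour-p i ⟨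
        colour i (p i)          ≡⟨ colour-sym i (p i) (fixed-free i ∘ sym) (λ sub → avoids i (p i) sub (colour-p i))
                                 ⟩
        colour (p i) i          ∎)

  points-even : 2 ∣ N
  points-even = colour-class-even γ (γ-new 0F ∘ sym) avoids
    where
    forbidden : Fin 3 → Fin N
    forbidden 0F = excluded
    forbidden 1F = colour 0F 1F
    forbidden 2F = colour 1F 0F
    γ = proj₁ (avoid forbidden (s≤s (s≤s (s≤s (s≤s z≤n)))))
    γ-new = proj₂ (avoid forbidden (s≤s (s≤s (s≤s (s≤s z≤n)))))
    avoids : ∀ i j → Subdivided i j → colour i j ≢ γ
    avoids _ _ (inj₁ (refl , refl)) = γ-new 1F
    avoids _ _ (inj₂ (refl , refl)) = γ-new 2F

  points+w-even : 2 ∣ suc N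
  points+w-even = fixedPointFreeInvolution⇒even (suc N) P P-fixed-free P-involutive
    where
    α = colour 0F 1F

    α≢excluded : α ≢ excluded
    α≢excluded = colour≢excluded 0F 1F λ ()

    q : Fin N → Fin N
    q i = proj₁ (partner i α α≢excluded)
    q-fixed-free : ∀ i → q i ≢ i
    q-fixed-free i eq = proj₁ (proj₂ (partner i α α≢excluded)) (sym eq)
    colour-q : ∀ i → colour i (q i) ≡ α
    colour-q i = proj₂ (proj₂ (partner i α α≢excluded))

    q≢0 : ∀ i → q (Fin.suc i) ≢ 0F
    q≢0 0F q1≡0 = colour-halves (sym (trans (cong (colour 1F) (sym q1≡0)) (colour-q 1F)))
    q≢0 (Fin.suc i) q≡0 = Fin.0≢1+n (Fin.suc-injective (colour-injective 0F 1F (2+i) (λ ()) (λ ()) (begin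
      α                       ≡⟨ colour-q (2+i) ⟨
      colour (2+i) (q (2+i))  ≡⟨ cong (colour (2+i)) q≡0 ⟩
      colour (2+i) 0F         ≡⟨ colour-sym (2+i) 0F (λ ()) (λ { (inj₁ ()) ; (inj₂ ()) }) ⟩
      colour 0F (2+i)         ∎)))
      where 2+i = Fin.suc (Fin.suc i)

    q-involutive : ∀ i → q (q (Fin.suc i)) ≡ Fin.suc i
    q-involutive i = colour-injective (q i+1) (q (q i+1)) i+1 (q-fixed-free (q i+1) ∘ sym) (q-fixed-free i+1)
      (begin
        colour (q i+1) (q (q i+1))  ≡⟨ colour-q (q i+1) ⟩
        α                           ≡⟨ colour-q i+1 ⟨
        colour i+1 (q i+1)          ≡⟨ colour-sym i+1 (q i+1) (q-fixed-free i+1 ∘ sym) not-halves ⟩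
        colour (q i+1) i+1          ∎)
      where
      i+1 = Fin.suc i
      not-halves : ¬ Subdivided i+1 (q i+1)
      not-halves (inj₁ (() , _))
      not-halves (inj₂ (_ , q≡0)) = q≢0 i q≡0

    -- The point zero stands for the degree-2 vertex, which the colour α matches with 0.
    P : Fin (suc N) → Fin (suc N)
    P Fin.zero = 1F
    P 1F = Fin.zero
    P (Fin.suc (Fin.suc i)) = Fin.suc (q (Fin.suc i))

    P-fixed-free : ∀ i → P i ≢ i
    P-fixed-free Fin.zero ()
    P-fixed-free 1F ()
    P-fixed-free (Fin.suc (Fin.suc i)) eq = q-fixed-free (Fin.suc i) (Fin.suc-injective eq)

    P-suc : ∀ j → j ≢ 0F → P (Fin.suc j) ≡ Fin.suc (q j)
    P-suc 0F j≢0 = ⊥-elim (j≢0 refl)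
    P-suc (Fin.suc j) _ = refl

    P-involutive : ∀ i → P (P i) ≡ i
    P-involutive Fin.zero = refl
    P-involutive 1F = refl
    P-involutive (Fin.suc (Fin.suc i)) = trans (P-suc (q (Fin.suc i)) (q≢0 i)) (cong Fin.suc (q-involutive i))

-- Pairs of points

module Pairs {V : Set} (_≟_ : DecidableEquality V) where

  _∈ₚ_ : V → V × V → Set
  v ∈ₚ (a , b) = v ≡ a ⊎ v ≡ b

  _∈ₚ?_ : ∀ v p → Dec (v ∈ₚ p)
  v ∈ₚ? (a , b) with v ≟ a | v ≟ b
  ... | yes v≡a | _     = yes (inj₁ v≡a)
  ... | no _    | yes v≡b = yes (inj₂ v≡b)
  ... | no v≢a  | no v≢b  = no λ { (inj₁ v≡a) → v≢a v≡a ; (inj₂ v≡b) → v≢b v≡b }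

  shareEnd⇒common : ∀ p q → shareEnd p q → ∃ λ v → v ∈ₚ p × v ∈ₚ q
  shareEnd⇒common (a , b) (c , d) (inj₁ a≡c)               = a , inj₁ refl , inj₁ a≡c
  shareEnd⇒common (a , b) (c , d) (inj₂ (inj₁ a≡d))        = a , inj₁ refl , inj₂ a≡d
  shareEnd⇒common (a , b) (c , d) (inj₂ (inj₂ (inj₁ b≡c))) = b , inj₂ refl , inj₁ b≡c
  shareEnd⇒common (a , b) (c , d) (inj₂ (inj₂ (inj₂ b≡d))) = b , inj₂ refl , inj₂ b≡d

  common⇒shareEnd : ∀ {v} p q → v ∈ₚ p → v ∈ₚ q → shareEnd p q
  common⇒shareEnd (a , b) (c , d) (inj₁ refl) (inj₁ refl) = inj₁ refl
  common⇒shareEnd (a , b) (c , d) (inj₁ refl) (inj₂ refl) = inj₂ (inj₁ refl)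
  common⇒shareEnd (a , b) (c , d) (inj₂ refl) (inj₁ refl) = inj₂ (inj₂ (inj₁ refl))
  common⇒shareEnd (a , b) (c , d) (inj₂ refl) (inj₂ refl) = inj₂ (inj₂ (inj₂ refl))

  shareEnd-sym : ∀ p q → shareEnd p q → shareEnd q p
  shareEnd-sym p q p~q with shareEnd⇒common p q p~q
  ... | _ , v∈p , v∈q = common⇒shareEnd q p v∈q v∈p

  shareEnd? : ∀ p q → Dec (shareEnd p q)
  shareEnd? (a , b) (c , d) = a ≟ c ⊎-dec a ≟ d ⊎-dec b ≟ c ⊎-dec b ≟ d

  ∈ₚ-one-of : ∀ {u v w} p → u ∈ₚ p → v ∈ₚ p → u ≢ v → w ∈ₚ p → w ≡ u ⊎ w ≡ v
  ∈ₚ-one-of p (inj₁ refl) (inj₁ refl) u≢v _ = ⊥-elim (u≢v refl)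
  ∈ₚ-one-of p (inj₂ refl) (inj₂ refl) u≢v _ = ⊥-elim (u≢v refl)
  ∈ₚ-one-of p (inj₁ refl) (inj₂ refl) _ (inj₁ refl) = inj₁ refl
  ∈ₚ-one-of p (inj₁ refl) (inj₂ refl) _ (inj₂ refl) = inj₂ refl
  ∈ₚ-one-of p (inj₂ refl) (inj₁ refl) _ (inj₁ refl) = inj₂ refl
  ∈ₚ-one-of p (inj₂ refl) (inj₁ refl) _ (inj₂ refl) = inj₁ refl

  same-points : ∀ {u v} p q → u ≢ v → u ∈ₚ p → v ∈ₚ p → u ∈ₚ q → v ∈ₚ q → p ≡ q ⊎ p ≡ swap q
  same-points _ _ u≢v (inj₁ refl) (inj₁ refl) _ _ = ⊥-elim (u≢v refl)
  same-points _ _ u≢v (inj₂ refl) (inj₂ refl) _ _ = ⊥-elim (u≢v refl)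
  same-points _ _ u≢v _ _ (inj₁ refl) (inj₁ refl) = ⊥-elim (u≢v refl)
  same-points _ _ u≢v _ _ (inj₂ refl) (inj₂ refl) = ⊥-elim (u≢v refl)
  same-points _ _ _ (inj₁ refl) (inj₂ refl) (inj₁ refl) (inj₂ refl) = inj₁ refl
  same-points _ _ _ (inj₁ refl) (inj₂ refl) (inj₂ refl) (inj₁ refl) = inj₂ refl
  same-points _ _ _ (inj₂ refl) (inj₁ refl) (inj₁ refl) (inj₂ refl) = inj₂ refl
  same-points _ _ _ (inj₂ refl) (inj₁ refl) (inj₂ refl) (inj₁ refl) = inj₁ refl

  NonParallel : V × V → V × V → Set
  NonParallel p q = ∀ {u v} → u ≢ v → u ∈ₚ p → v ∈ₚ p → u ∈ₚ q → v ∈ₚ q → ⊥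

  meets-away : ∀ {u} p q → u ∈ₚ p → ¬ u ∈ₚ q → shareEnd p q → ∃ λ o → o ≢ u × o ∈ₚ p × o ∈ₚ q
  meets-away p q u∈p u∉q p~q with shareEnd⇒common p q p~q
  ... | o , o∈p , o∈q = o , (λ { refl → u∉q o∈q }) , o∈p , o∈q

  -- Otherwise q would meet p₀, p₁ and p₂ in three distinct points.
  through-common-point : ∀ {u} p₀ p₁ p₂ q → u ∈ₚ p₀ → u ∈ₚ p₁ → u ∈ₚ p₂ →
    NonParallel p₀ p₁ → NonParallel p₀ p₂ → NonParallel p₁ p₂ →
    shareEnd p₀ q → shareEnd p₁ q → shareEnd p₂ q → u ∈ₚ q
  through-common-point {u} p₀ p₁ p₂ q u∈₀ u∈₁ u∈₂ ∦₀₁ ∦₀₂ ∦₁₂ q~₀ q~₁ q~₂ with u ∈ₚ? q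
  ... | yes u∈q = u∈q
  ... | no u∉q
    with meets-away p₀ q u∈₀ u∉q q~₀ | meets-away p₁ q u∈₁ u∉q q~₁ | meets-away p₂ q u∈₂ u∉q q~₂
  ... | o₀ , o₀≢u , o₀∈₀ , o₀∈q | o₁ , o₁≢u , o₁∈₁ , o₁∈q | o₂ , o₂≢u , o₂∈₂ , o₂∈q
    with ∈ₚ-one-of q o₀∈q o₁∈q o₀≢o₁ o₂∈q
    where
    o₀≢o₁ : o₀ ≢ o₁
    o₀≢o₁ refl = ∦₀₁ (o₀≢u ∘ sym) u∈₀ o₀∈₀ u∈₁ o₁∈₁
  ... | inj₁ refl = ⊥-elim (∦₀₂ (o₂≢u ∘ sym) u∈₀ o₀∈₀ u∈₂ o₂∈₂)
  ... | inj₂ refl = ⊥-elim (∦₁₂ (o₂≢u ∘ sym) u∈₁ o₁∈₁ u∈₂ o₂∈₂)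

  PairwiseMeeting : ∀ {k} → (Fin k → V × V) → Set
  PairwiseMeeting y = ∀ a b → a ≢ b → shareEnd (y a) (y b) × NonParallel (y a) (y b)

  module _ {k} (y : Fin (4 + k) → V × V) (meeting : PairwiseMeeting y) where
    private
      meet : ∀ a b → a ≢ b → shareEnd (y a) (y b)
      meet a b a≢b = proj₁ (meeting a b a≢b)
      ∦ : ∀ a b → a ≢ b → NonParallel (y a) (y b)
      ∦ a b a≢b = proj₂ (meeting a b a≢b)

    -- Three pairwise meeting pairs without a common point form a triangle, and a fourth pair
    -- meeting all of them would have to be parallel to one of its sides.
    pairwiseMeeting⇒common : ∃ λ u → ∀ a → u ∈ₚ y a
    pairwiseMeeting⇒common with shareEnd⇒common (y 0F) (y 1F) (meet 0F 1F λ ())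
    ... | u , u∈₀ , u∈₁ with u ∈ₚ? y 2F
    ... | yes u∈₂ = u , through-u
      where
      through-u : ∀ a → u ∈ₚ y a
      through-u 0F = u∈₀
      through-u 1F = u∈₁
      through-u 2F = u∈₂
      through-u a@(Fin.suc (Fin.suc (Fin.suc _))) = through-common-point (y 0F) (y 1F) (y 2F) (y a) u∈₀ u∈₁ u∈₂
        (∦ 0F 1F λ ()) (∦ 0F 2F λ ()) (∦ 1F 2F λ ()) (meet 0F a λ ()) (meet 1F a λ ()) (meet 2F a λ ())
    ... | no u∉₂
      with meets-away (y 0F) (y 2F) u∈₀ u∉₂ (meet 0F 2F λ ()) | meets-away (y 1F) (y 2F) u∈₁ u∉₂ (meet 1F 2F λ ())
    ... | o₀ , o₀≢u , o₀∈₀ , o₀∈₂ | o₁ , o₁≢u , o₁∈₁ , o₁∈₂ =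
      ⊥-elim (fourth-pair (u ∈ₚ? y 3F))
      where
      o₀≢o₁ : o₀ ≢ o₁
      o₀≢o₁ refl = ∦ 0F 1F (λ ()) (o₀≢u ∘ sym) u∈₀ o₀∈₀ u∈₁ o₁∈₁

      away-from-u : ∀ {o p} → u ∈ₚ p → o ∈ₚ p → o ≢ u → ∀ {z} → z ∈ₚ p → z ≢ u → z ≡ o
      away-from-u {p = p} u∈p o∈p o≢u z∈p z≢u with ∈ₚ-one-of p u∈p o∈p (o≢u ∘ sym) z∈p
      ... | inj₁ z≡u = ⊥-elim (z≢u z≡u)
      ... | inj₂ z≡o = z≡o

      fourth-pair : Dec (u ∈ₚ y 3F) → ⊥
      fourth-pair (yes u∈₃) with shareEnd⇒common (y 2F) (y 3F) (meet 2F 3F λ ())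
      ... | z , z∈₂ , z∈₃ with ∈ₚ-one-of (y 2F) o₀∈₂ o₁∈₂ o₀≢o₁ z∈₂
      ... | inj₁ refl = ∦ 0F 3F (λ ()) (o₀≢u ∘ sym) u∈₀ o₀∈₀ u∈₃ z∈₃
      ... | inj₂ refl = ∦ 1F 3F (λ ()) (o₁≢u ∘ sym) u∈₁ o₁∈₁ u∈₃ z∈₃
      fourth-pair (no u∉₃)
        with meets-away (y 0F) (y 3F) u∈₀ u∉₃ (meet 0F 3F λ ()) | meets-away (y 1F) (y 3F) u∈₁ u∉₃ (meet 1F 3F λ ())
      ... | z₀ , z₀≢u , z₀∈₀ , z₀∈₃ | z₁ , z₁≢u , z₁∈₁ , z₁∈₃
        with away-from-u u∈₀ o₀∈₀ o₀≢u z₀∈₀ z₀≢u | away-from-u u∈₁ o₁∈₁ o₁≢u z₁∈₁ z₁≢u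
      ... | refl | refl = ∦ 2F 3F (λ ()) o₀≢o₁ o₀∈₂ o₁∈₂ z₀∈₃ z₁∈₃

-- The graphs G_{n,d}

module _ {n : ℕ} where

  _≟ₛ_ : DecidableEquality (SV n)
  cyc i ≟ₛ cyc j = map′ (cong cyc) (λ { refl → refl }) (i Fin.≟ j)
  pen i ≟ₛ pen j = map′ (cong pen) (λ { refl → refl }) (i Fin.≟ j)
  cyc _ ≟ₛ pen _ = no λ ()
  pen _ ≟ₛ cyc _ = no λ ()

  _≟ₑ_ : DecidableEquality (SE n)
  cycE i ≟ₑ cycE j = map′ (cong cycE) (λ { refl → refl }) (i Fin.≟ j)
  penE i ≟ₑ penE j = map′ (cong penE) (λ { refl → refl }) (i Fin.≟ j)
  cycE _ ≟ₑ penE _ = no λ ()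
  penE _ ≟ₑ cycE _ = no λ ()

kv-injective : ∀ {n d b b′ i j} → kv {n} {d} b i ≡ kv b′ j → b ≡ b′ × i ≡ j
kv-injective refl = refl , refl

module _ {n d : ℕ} where

  _≟ᵥ_ : DecidableEquality (GV n d)
  sv x   ≟ᵥ sv y   = map′ (cong sv) (λ { refl → refl }) (x ≟ₛ y)
  cv x   ≟ᵥ cv y   = map′ (cong cv) (λ { refl → refl }) (x ≟ₑ y)
  wv x   ≟ᵥ wv y   = map′ (cong wv) (λ { refl → refl }) (x ≟ₑ y)
  kv x i ≟ᵥ kv y j = map′ (λ (x≡y , i≡j) → cong₂ kv x≡y i≡j) kv-injective (x ≟ₑ y ×-dec i Fin.≟ j)
  sv _   ≟ᵥ cv _   = no λ ()
  sv _   ≟ᵥ kv _ _ = no λ ()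
  sv _   ≟ᵥ wv _   = no λ ()
  cv _   ≟ᵥ sv _   = no λ ()
  cv _   ≟ᵥ kv _ _ = no λ ()
  cv _   ≟ᵥ wv _   = no λ ()
  kv _ _ ≟ᵥ sv _   = no λ ()
  kv _ _ ≟ᵥ cv _   = no λ ()
  kv _ _ ≟ᵥ wv _   = no λ ()
  wv _   ≟ᵥ sv _   = no λ ()
  wv _   ≟ᵥ cv _   = no λ ()
  wv _   ≟ᵥ kv _ _ = no λ ()

open module Incidence {n d : ℕ} = Pairs (_≟ᵥ_ {n} {d})

module _ {n d : ℕ} where

  edge-at-c : ∀ {e} y → cv e ∈ₚ gEnds {n} {suc d} y → y ≡ acE e ⊎ y ≡ cbE e ⊎ y ≡ cwE e
  edge-at-c (acE _) (inj₂ refl) = inj₁ refl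
  edge-at-c (cbE _) (inj₁ refl) = inj₂ (inj₁ refl)
  edge-at-c (cwE _) (inj₁ refl) = inj₂ (inj₂ refl)
  edge-at-c (acE _) (inj₁ ())
  edge-at-c (cbE _) (inj₂ ())
  edge-at-c (cwE _) (inj₂ ())
  edge-at-c (w0E _) (inj₁ ())
  edge-at-c (w0E _) (inj₂ ())
  edge-at-c (w1E _) (inj₁ ())
  edge-at-c (w1E _) (inj₂ ())
  edge-at-c (kkE _ _ _ _ _) (inj₁ ())
  edge-at-c (kkE _ _ _ _ _) (inj₂ ())

  edge-at-w : ∀ {e} y → wv e ∈ₚ gEnds {n} {suc d} y → y ≡ cwE e ⊎ y ≡ w0E e ⊎ y ≡ w1E e
  edge-at-w (cwE _) (inj₂ refl) = inj₁ refl
  edge-at-w (w0E _) (inj₁ refl) = inj₂ (inj₁ refl)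
  edge-at-w (w1E _) (inj₁ refl) = inj₂ (inj₂ refl)
  edge-at-w (acE _) (inj₁ ())
  edge-at-w (acE _) (inj₂ ())
  edge-at-w (cbE _) (inj₁ ())
  edge-at-w (cbE _) (inj₂ ())
  edge-at-w (cwE _) (inj₁ ())
  edge-at-w (w0E _) (inj₂ ())
  edge-at-w (w1E _) (inj₂ ())
  edge-at-w (kkE _ _ _ _ _) (inj₁ ())
  edge-at-w (kkE _ _ _ _ _) (inj₂ ())

  cw~w0 : ∀ {e} → Graph.Adj (L (G n (suc d))) (cwE e) (w0E e)
  cw~w0 = (λ ()) , inj₂ (inj₂ (inj₁ refl))

  cw~w1 : ∀ {e} → Graph.Adj (L (G n (suc d))) (cwE e) (w1E e)
  cw~w1 = (λ ()) , inj₂ (inj₂ (inj₁ refl))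

  w0~w1 : ∀ {e} → Graph.Adj (L (G n (suc d))) (w0E e) (w1E e)
  w0~w1 = (λ ()) , inj₁ refl

  kkE-irrelevant : ∀ {e i j} {i<j i<j′ : toℕ i < toℕ j} {2≤j 2≤j′ : 2 ≤ toℕ j} →
                   kkE {n} {suc d} e i j i<j 2≤j ≡ kkE e i j i<j′ 2≤j′
  kkE-irrelevant {i<j = i<j} {i<j′} {2≤j} {2≤j′} =
    cong₂ (kkE _ _ _) (ℕ.<-irrelevant i<j i<j′) (ℕ.≤-irrelevant 2≤j 2≤j′)

  -- kEdge e i j is the edge of the dragon at kᵢ pointing towards kⱼ: the edge {i, j} of K_{d+2},
  -- except that {0, 1} is subdivided, so kEdge e 0 1 = w0E e and kEdge e 1 0 = w1E e.  The value
  -- for i = j is junk.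
  kEdge : SE n → Fin (2 + d) → Fin (2 + d) → GE n (suc d)
  kEdge e i j with ℕ.<-cmp (toℕ i) (toℕ j) | 2 ℕ.≤? toℕ j | 2 ℕ.≤? toℕ i
  ... | tri< i<j _ _ | yes 2≤j | _       = kkE e i j i<j 2≤j
  ... | tri< _ _ _   | no _    | _       = w0E e
  ... | tri> _ _ j<i | _       | yes 2≤i = kkE e j i j<i 2≤i
  ... | tri> _ _ _   | _       | no _    = w1E e
  ... | tri≈ _ _ _   | _       | _       = w0E e

  data KEdgeView (e : SE n) (i j : Fin (2 + d)) : GE n (suc d) → Set where
    forward  : (i<j : toℕ i < toℕ j) (2≤j : 2 ≤ toℕ j) → KEdgeView e i j (kkE e i j i<j 2≤j)
    backward : (j<i : toℕ j < toℕ i) (2≤i : 2 ≤ toℕ i) → KEdgeView e i j (kkE e j i j<i 2≤i)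
    half₀    : i ≡ 0F → j ≡ 1F → KEdgeView e i j (w0E e)
    half₁    : i ≡ 1F → j ≡ 0F → KEdgeView e i j (w1E e)

  private
    below2 : ∀ (i j : Fin (2 + d)) → toℕ i < toℕ j → ¬ 2 ≤ toℕ j → i ≡ 0F × j ≡ 1F
    below2 0F 1F _ _ = refl , refl
    below2 _ (Fin.suc (Fin.suc _)) _ j≱2 = ⊥-elim (j≱2 (s≤s (s≤s z≤n)))
    below2 0F 0F () _
    below2 1F 0F () _
    below2 1F 1F (s≤s ()) _
    below2 (Fin.suc (Fin.suc _)) 0F () _
    below2 (Fin.suc (Fin.suc _)) 1F (s≤s ()) _

  kEdge-view : ∀ e i j → i ≢ j → KEdgeView e i j (kEdge e i j)
  kEdge-view e i j i≢j with ℕ.<-cmp (toℕ i) (toℕ j) | 2 ℕ.≤? toℕ j | 2 ℕ.≤? toℕ i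
  ... | tri< i<j _ _ | yes 2≤j | _       = forward i<j 2≤j
  ... | tri< i<j _ _ | no j≱2  | _       = let i≡0 , j≡1 = below2 i j i<j j≱2 in half₀ i≡0 j≡1
  ... | tri> _ _ j<i | _       | yes 2≤i = backward j<i 2≤i
  ... | tri> _ _ j<i | _       | no i≱2  = let j≡0 , i≡1 = below2 j i j<i i≱2 in half₁ i≡1 j≡0
  ... | tri≈ _ i≡j _ | _       | _       = ⊥-elim (i≢j (Fin.toℕ-injective i≡j))

  kEdge-at : ∀ e i j → i ≢ j → kv e i ∈ₚ gEnds (kEdge e i j)
  kEdge-at e i j i≢j with kEdge e i j | kEdge-view e i j i≢j
  ... | _ | forward _ _     = inj₁ refl
  ... | _ | backward _ _    = inj₂ refl
  ... | _ | half₀ refl refl = inj₂ refl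
  ... | _ | half₁ refl refl = inj₂ refl

  kEdge-kv : ∀ {b b′ t} i j → i ≢ j → kv b′ t ∈ₚ gEnds (kEdge b i j) →
             b′ ≡ b × (t ≡ i ⊎ t ≡ j × ¬ Subdivided i j)
  kEdge-kv {b} i j i≢j t∈ with kEdge b i j | kEdge-view b i j i≢j
  kEdge-kv i j _ (inj₁ refl) | _ | forward _ _     = refl , inj₁ refl
  kEdge-kv i j _ (inj₂ refl) | _ | forward _ 2≤j   = refl , inj₂ (refl , ¬Subdivided-2≤ʳ 2≤j)
  kEdge-kv i j _ (inj₁ refl) | _ | backward _ 2≤i  = refl , inj₂ (refl , ¬Subdivided-2≤ˡ 2≤i)
  kEdge-kv i j _ (inj₂ refl) | _ | backward _ _    = refl , inj₁ refl
  kEdge-kv i j _ (inj₂ refl) | _ | half₀ refl refl = refl , inj₁ refl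
  kEdge-kv i j _ (inj₂ refl) | _ | half₁ refl refl = refl , inj₁ refl
  kEdge-kv i j _ (inj₁ ())   | _ | half₀ _ _
  kEdge-kv i j _ (inj₁ ())   | _ | half₁ _ _

  private
    <⇒≢ : ∀ {i j : Fin (2 + d)} → toℕ i < toℕ j → i ≢ j
    <⇒≢ i<j refl = ℕ.<-irrefl refl i<j

  kEdge-forward : ∀ e i j (i<j : toℕ i < toℕ j) (2≤j : 2 ≤ toℕ j) → kEdge e i j ≡ kkE e i j i<j 2≤j
  kEdge-forward e i j i<j 2≤j with kEdge e i j | kEdge-view e i j (<⇒≢ i<j)
  ... | _ | forward _ _     = kkE-irrelevant
  ... | _ | backward j<i _  = ⊥-elim (ℕ.<-asym i<j j<i)
  ... | _ | half₀ refl refl with s≤s () ← 2≤j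
  ... | _ | half₁ refl refl with () ← 2≤j

  kEdge-backward : ∀ e i j (i<j : toℕ i < toℕ j) (2≤j : 2 ≤ toℕ j) → kEdge e j i ≡ kkE e i j i<j 2≤j
  kEdge-backward e i j i<j 2≤j with kEdge e j i | kEdge-view e j i (<⇒≢ i<j ∘ sym)
  ... | _ | forward j<i _   = ⊥-elim (ℕ.<-asym i<j j<i)
  ... | _ | backward _ _    = kkE-irrelevant
  ... | _ | half₀ refl refl with () ← 2≤j
  ... | _ | half₁ refl refl with s≤s () ← 2≤j

  kEdge-sym : ∀ e i j → i ≢ j → ¬ Subdivided i j → kEdge e i j ≡ kEdge e j i
  kEdge-sym e i j i≢j ¬sub = by-order (ℕ.<-cmp (toℕ i) (toℕ j)) (2 ℕ.≤? toℕ j) (2 ℕ.≤? toℕ i)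
    where
    by-order : Tri (toℕ i < toℕ j) (toℕ i ≡ toℕ j) (toℕ j < toℕ i) → Dec (2 ≤ toℕ j) → Dec (2 ≤ toℕ i) →
               kEdge e i j ≡ kEdge e j i
    by-order (tri< i<j _ _) (yes 2≤j) _ = trans (kEdge-forward e i j i<j 2≤j) (sym (kEdge-backward e i j i<j 2≤j))
    by-order (tri< i<j _ _) (no j≱2)  _ = ⊥-elim (¬sub (inj₁ (below2 i j i<j j≱2)))
    by-order (tri> _ _ j<i) _ (yes 2≤i) = trans (kEdge-backward e j i j<i 2≤i) (sym (kEdge-forward e j i j<i 2≤i))
    by-order (tri> _ _ j<i) _ (no i≱2)  = ⊥-elim (¬sub (Subdivided-sym (inj₁ (below2 j i j<i i≱2))))
    by-order (tri≈ _ i≡j _) _ _         = ⊥-elim (i≢j (Fin.toℕ-injective i≡j))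

  from-other-end : ∀ (P : GE n (suc d) → Set) {e} i j → i ≢ j → ¬ Subdivided i j → P (kEdge e j i) → P (kEdge e i j)
  from-other-end P {e} i j i≢j ¬sub = subst P (sym (kEdge-sym e i j i≢j ¬sub))

  kEdge-at′ : ∀ e i j → i ≢ j → ¬ Subdivided i j → kv e j ∈ₚ gEnds (kEdge e i j)
  kEdge-at′ e i j i≢j ¬sub = from-other-end (λ y → kv e j ∈ₚ gEnds y) i j i≢j ¬sub (kEdge-at e j i (i≢j ∘ sym))

  edge-at-kv : ∀ {e i} y → kv e i ∈ₚ gEnds y → ∃ λ j → i ≢ j × y ≡ kEdge e i j
  edge-at-kv (w0E _) (inj₂ refl) = 1F , (λ ()) , refl
  edge-at-kv (w1E _) (inj₂ refl) = 0F , (λ ()) , refl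
  edge-at-kv (kkE e i j i<j 2≤j) (inj₁ refl) = j , <⇒≢ i<j , sym (kEdge-forward e i j i<j 2≤j)
  edge-at-kv (kkE e i j i<j 2≤j) (inj₂ refl) = i , <⇒≢ i<j ∘ sym , sym (kEdge-backward e i j i<j 2≤j)
  edge-at-kv (acE _) (inj₁ ())
  edge-at-kv (acE _) (inj₂ ())
  edge-at-kv (cbE _) (inj₁ ())
  edge-at-kv (cbE _) (inj₂ ())
  edge-at-kv (cwE _) (inj₁ ())
  edge-at-kv (cwE _) (inj₂ ())
  edge-at-kv (w0E _) (inj₁ ())
  edge-at-kv (w1E _) (inj₁ ())

  kEdge-far-end : ∀ {e t} i j → i ≢ j → kv e t ∈ₚ gEnds (kEdge e i j) → t ≢ i → t ≡ j
  kEdge-far-end i j i≢j t∈ t≢i with kEdge-kv i j i≢j t∈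
  ... | _ , inj₁ t≡i       = ⊥-elim (t≢i t≡i)
  ... | _ , inj₂ (t≡j , _) = t≡j

  kEdge-injective : ∀ e i j j′ → i ≢ j → i ≢ j′ → kEdge e i j ≡ kEdge e i j′ → j ≡ j′
  kEdge-injective e i j j′ i≢j i≢j′ eq with Subdivided? i j | Subdivided? i j′
  ... | yes sub | yes sub′ = Subdivided-functional sub sub′
  ... | _ | no ¬sub′ =
    sym (kEdge-far-end i j i≢j (subst (λ y → kv e j′ ∈ₚ gEnds y) (sym eq) (kEdge-at′ e i j′ i≢j′ ¬sub′))
                       (i≢j′ ∘ sym))
  ... | no ¬sub | _ =
    kEdge-far-end i j′ i≢j′ (subst (λ y → kv e j ∈ₚ gEnds y) eq (kEdge-at′ e i j i≢j ¬sub)) (i≢j ∘ sym)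

  kv-pair⇒kEdge : ∀ {b b′ i j} y → kv b i ∈ₚ gEnds y → kv b′ j ∈ₚ gEnds y → kv b i ≢ kv b′ j →
                  b′ ≡ b × ¬ Subdivided i j × y ≡ kEdge b i j
  kv-pair⇒kEdge y i∈ j∈ distinct with edge-at-kv y i∈
  ... | t , i≢t , refl with kEdge-kv _ t i≢t j∈
  ...   | refl , inj₁ refl         = ⊥-elim (distinct refl)
  ...   | refl , inj₂ (refl , ¬sub) = refl , ¬sub , refl

  star-adjacent : ∀ e i j j′ → i ≢ j → i ≢ j′ → j ≢ j′ →
                  Graph.Adj (L (G n (suc d))) (kEdge e i j) (kEdge e i j′)
  star-adjacent e i j j′ i≢j i≢j′ j≢j′ =
    j≢j′ ∘ kEdge-injective e i j j′ i≢j i≢j′ , common⇒shareEnd _ _ (kEdge-at e i j i≢j) (kEdge-at e i j′ i≢j′)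

  kv-pair-determines : ∀ {b b′ i j} y y′ → kv b i ≢ kv b′ j → kv b i ∈ₚ gEnds y → kv b′ j ∈ₚ gEnds y →
                       kv b i ∈ₚ gEnds y′ → kv b′ j ∈ₚ gEnds y′ → y ≡ y′
  kv-pair-determines y y′ distinct i∈y j∈y i∈y′ j∈y′ =
    trans (proj₂ (proj₂ (kv-pair⇒kEdge y i∈y j∈y distinct)))
          (sym (proj₂ (proj₂ (kv-pair⇒kEdge y′ i∈y′ j∈y′ distinct))))

-- Folding the sunlet onto a loop

-- suc a % n is suc a when suc a < n, and 0 when suc a = n.
suc%-injective : ∀ {a b n} .{{_ : NonZero n}} → a < n → b < n → suc a % n ≡ suc b % n → a ≡ b
suc%-injective {a} {b} {n} a<n b<n eq with ℕ.m≤n⇒m<n∨m≡n a<n | ℕ.m≤n⇒m<n∨m≡n b<n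
... | inj₁ 1+a<n | inj₁ 1+b<n = ℕ.suc-injective (trans (sym (m<n⇒m%n≡m 1+a<n)) (trans eq (m<n⇒m%n≡m 1+b<n)))
... | inj₂ 1+a≡n | inj₂ 1+b≡n = ℕ.suc-injective (trans 1+a≡n (sym 1+b≡n))
... | inj₁ 1+a<n | inj₂ 1+b≡n
  with () ← trans (sym (m<n⇒m%n≡m 1+a<n)) (trans eq (trans (cong (_% n) 1+b≡n) (n%n≡0 n)))
... | inj₂ 1+a≡n | inj₁ 1+b<n
  with () ← trans (sym (m<n⇒m%n≡m 1+b<n)) (trans (sym eq) (trans (cong (_% n) 1+a≡n) (n%n≡0 n)))

next-injective : ∀ {n} → Injective _≡_ _≡_ (next {n})
next-injective {suc m} {i} {j} eq = Fin.toℕ-injective (suc%-injective (Fin.toℕ<n i) (Fin.toℕ<n j) (begin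
  suc (toℕ i) % suc m   ≡⟨ Fin.toℕ-fromℕ< _ ⟨
  toℕ (next i)          ≡⟨ cong toℕ eq ⟩
  toℕ (next j)          ≡⟨ Fin.toℕ-fromℕ< _ ⟩
  suc (toℕ j) % suc m   ∎))

copy : ∀ {n d} → GE n d → SE n
copy (acE e)         = e
copy (cbE e)         = e
copy (cwE e)         = e
copy (w0E e)         = e
copy (w1E e)         = e
copy (kkE e _ _ _ _) = e

at-sunlet : ∀ {n d s} (x : GE n (suc d)) → sv s ∈ₚ gEnds x →
            (∃ λ (e : SE n) → x ≡ acE e × s ≡ proj₁ (sEnds e)) ⊎
            (∃ λ (e : SE n) → x ≡ cbE e × s ≡ proj₂ (sEnds e))
at-sunlet (acE e) (inj₁ refl) = inj₁ (e , refl , refl)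
at-sunlet (cbE e) (inj₂ refl) = inj₂ (e , refl , refl)
at-sunlet (acE _) (inj₂ ())
at-sunlet (cbE _) (inj₁ ())
at-sunlet (cwE _) (inj₁ ())
at-sunlet (cwE _) (inj₂ ())
at-sunlet (w0E _) (inj₁ ())
at-sunlet (w0E _) (inj₂ ())
at-sunlet (w1E _) (inj₁ ())
at-sunlet (w1E _) (inj₂ ())
at-sunlet (kkE _ _ _ _ _) (inj₁ ())
at-sunlet (kkE _ _ _ _ _) (inj₂ ())

module Fold {n d : ℕ} where

  foldₛ : SV n → SV 1
  foldₛ (cyc _) = cyc 0F
  foldₛ (pen _) = pen 0F

  foldₑ : SE n → SE 1
  foldₑ (cycE _) = cycE 0F
  foldₑ (penE _) = penE 0F

  foldᵥ : GV n (suc d) → GV 1 (suc d)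
  foldᵥ (sv s)   = sv (foldₛ s)
  foldᵥ (cv e)   = cv (foldₑ e)
  foldᵥ (kv e i) = kv (foldₑ e) i
  foldᵥ (wv e)   = wv (foldₑ e)

  fold : GE n (suc d) → GE 1 (suc d)
  fold (acE e)           = acE (foldₑ e)
  fold (cbE e)           = cbE (foldₑ e)
  fold (cwE e)           = cwE (foldₑ e)
  fold (w0E e)           = w0E (foldₑ e)
  fold (w1E e)           = w1E (foldₑ e)
  fold (kkE e i j i<j 2≤j) = kkE (foldₑ e) i j i<j 2≤j

  sEnds-fold : ∀ e → sEnds (foldₑ e) ≡ (foldₛ (proj₁ (sEnds e)) , foldₛ (proj₂ (sEnds e)))
  sEnds-fold (cycE _) = refl
  sEnds-fold (penE _) = refl

  gEnds-fold : ∀ x → gEnds (fold x) ≡ (foldᵥ (proj₁ (gEnds x)) , foldᵥ (proj₂ (gEnds x)))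
  gEnds-fold (acE e) = cong (λ (a , _) → sv a , cv (foldₑ e)) (sEnds-fold e)
  gEnds-fold (cbE e) = cong (λ (_ , b) → cv (foldₑ e) , sv b) (sEnds-fold e)
  gEnds-fold (cwE e) = refl
  gEnds-fold (w0E e) = refl
  gEnds-fold (w1E e) = refl
  gEnds-fold (kkE e i j i<j 2≤j) = refl

  unfold : GE 1 (suc d) → SE n → GE n (suc d)
  unfold (acE _) e           = acE e
  unfold (cbE _) e           = cbE e
  unfold (cwE _) e           = cwE e
  unfold (w0E _) e           = w0E e
  unfold (w1E _) e           = w1E e
  unfold (kkE _ i j i<j 2≤j) e = kkE e i j i<j 2≤j

  unfold-fold : ∀ x → unfold (fold x) (copy x) ≡ x
  unfold-fold (acE _)           = refl
  unfold-fold (cbE _)           = refl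
  unfold-fold (cwE _)           = refl
  unfold-fold (w0E _)           = refl
  unfold-fold (w1E _)           = refl
  unfold-fold (kkE _ _ _ _ _)   = refl

  copyᵥ : GV n (suc d) → Maybe (SE n)
  copyᵥ (sv _)   = nothing
  copyᵥ (cv e)   = just e
  copyᵥ (kv e _) = just e
  copyᵥ (wv e)   = just e

  endpoint-copy : ∀ {v} (x : GE n (suc d)) → v ∈ₚ gEnds x → copyᵥ v ≡ just (copy x) ⊎ ∃ λ s → v ≡ sv s
  endpoint-copy (acE _)         (inj₁ refl) = inj₂ (_ , refl)
  endpoint-copy (acE _)         (inj₂ refl) = inj₁ refl
  endpoint-copy (cbE _)         (inj₁ refl) = inj₁ refl
  endpoint-copy (cbE _)         (inj₂ refl) = inj₂ (_ , refl)
  endpoint-copy (cwE _)         (inj₁ refl) = inj₁ refl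
  endpoint-copy (cwE _)         (inj₂ refl) = inj₁ refl
  endpoint-copy (w0E _)         (inj₁ refl) = inj₁ refl
  endpoint-copy (w0E _)         (inj₂ refl) = inj₁ refl
  endpoint-copy (w1E _)         (inj₁ refl) = inj₁ refl
  endpoint-copy (w1E _)         (inj₂ refl) = inj₁ refl
  endpoint-copy (kkE _ _ _ _ _) (inj₁ refl) = inj₁ refl
  endpoint-copy (kkE _ _ _ _ _) (inj₂ refl) = inj₁ refl

  -- foldₑ e ≡ foldₑ e′ says that e and e′ are both cycle edges or both pendant edges.
  tail-determines : ∀ {e e′} → foldₑ e ≡ foldₑ e′ → proj₁ (sEnds e) ≡ proj₁ (sEnds e′) → e ≡ e′
  tail-determines {cycE _} {cycE _} _ refl = refl
  tail-determines {penE _} {penE _} _ refl = refl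

  head-determines : ∀ {e e′} → foldₑ e ≡ foldₑ e′ → proj₂ (sEnds e) ≡ proj₂ (sEnds e′) → e ≡ e′
  head-determines {cycE _} {cycE _} _ eq = cong cycE (next-injective (cyc-injective eq))
    where cyc-injective : ∀ {i j : Fin n} → cyc i ≡ cyc j → i ≡ j
          cyc-injective refl = refl
  head-determines {penE _} {penE _} _ refl = refl

  sunlet-endpoint-copy : ∀ {s} (x y : GE n (suc d)) → sv s ∈ₚ gEnds x → sv s ∈ₚ gEnds y →
                         fold x ≡ fold y → copy x ≡ copy y
  sunlet-endpoint-copy x y s∈x s∈y eq with at-sunlet x s∈x | at-sunlet y s∈y
  ... | inj₁ (_ , refl , refl) | inj₁ (_ , refl , s≡) = tail-determines (cong copy eq) s≡
  ... | inj₂ (_ , refl , refl) | inj₂ (_ , refl , s≡) = head-determines (cong copy eq) s≡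
  ... | inj₁ (_ , refl , _)    | inj₂ (_ , refl , _) with () ← eq
  ... | inj₂ (_ , refl , _)    | inj₁ (_ , refl , _) with () ← eq

  fold-injective-adjacent : ∀ (x y : GE n (suc d)) → shareEnd (gEnds x) (gEnds y) → fold x ≡ fold y → x ≡ y
  fold-injective-adjacent x y x~y eq = begin
    x                          ≡⟨ unfold-fold x ⟨
    unfold (fold x) (copy x)   ≡⟨ cong₂ unfold eq same-copy ⟩
    unfold (fold y) (copy y)   ≡⟨ unfold-fold y ⟩
    y                          ∎
    where
    same-copy : copy x ≡ copy y
    same-copy with shareEnd⇒common (gEnds x) (gEnds y) x~y
    ... | v , v∈x , v∈y with endpoint-copy x v∈x | endpoint-copy y v∈y
    ...   | inj₁ ownedˣ | inj₁ ownedʸ = Maybe.just-injective (trans (sym ownedˣ) ownedʸ)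
    ...   | inj₂ (s , refl) | _ = sunlet-endpoint-copy x y v∈x v∈y eq
    ...   | _ | inj₂ (s , refl) = sunlet-endpoint-copy x y v∈x v∈y eq

  fold-hom : IsHom (L (G n (suc d))) (L (G 1 (suc d))) fold
  fold-hom {x} {y} (x≢y , x~y) = x≢y ∘ fold-injective-adjacent x y x~y ,
    subst₂ shareEnd (sym (gEnds-fold x)) (sym (gEnds-fold y)) (map-shareEnd (gEnds x) (gEnds y) x~y)
    where
    map-shareEnd : ∀ p q → shareEnd p q →
                   shareEnd (foldᵥ (proj₁ p) , foldᵥ (proj₂ p)) (foldᵥ (proj₁ q) , foldᵥ (proj₂ q))
    map-shareEnd _ _ (inj₁ eq)               = inj₁ (cong foldᵥ eq)
    map-shareEnd _ _ (inj₂ (inj₁ eq))        = inj₂ (inj₁ (cong foldᵥ eq))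
    map-shareEnd _ _ (inj₂ (inj₂ (inj₁ eq))) = inj₂ (inj₂ (inj₁ (cong foldᵥ eq)))
    map-shareEnd _ _ (inj₂ (inj₂ (inj₂ eq))) = inj₂ (inj₂ (inj₂ (cong foldᵥ eq)))

  fold-reflects-special : ∀ x → Special (fold x) → Special x
  fold-reflects-special (cwE e) _ = e , refl

-- The folded graph G_{1,d}

module Target {d : ℕ} where

  T : EdgeGraph
  T = G 1 (suc d)

  cc pp : SE 1
  cc = cycE 0F
  pp = penE 0F

  -- The only parallel edges of the folded graph: both join the cycle vertex to the c of its loop.
  Parallel : GE 1 (suc d) → GE 1 (suc d) → Set
  Parallel x y = (x ≡ acE cc × y ≡ cbE cc) ⊎ (x ≡ cbE cc × y ≡ acE cc)

  half : SE 1 → Fin (2 + d) → GE 1 (suc d)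
  half e 0F          = w0E e
  half e (Fin.suc _) = w1E e

  -- Reads an edge off its endpoints, given in either order; pairs that are not edges give junk.
  decode : GV 1 (suc d) × GV 1 (suc d) → GE 1 (suc d)
  decode (sv (cyc _) , cv e)          = acE e
  decode (sv (pen _) , cv e)          = cbE e
  decode (cv e , sv (pen _))          = cbE e
  decode (cv (cycE _) , sv (cyc _))   = cbE cc
  decode (cv (penE _) , sv (cyc _))   = acE pp
  decode (cv e , wv _)                = cwE e
  decode (wv e , cv _)                = cwE e
  decode (wv e , kv _ i)              = half e i
  decode (kv _ i , wv e)              = half e i
  decode (kv e i , kv _ j)            = kEdge e i j
  decode _                            = acE cc

  decode-gEnds : ∀ x → decode (gEnds x) ≡ x
  decode-gEnds (acE (cycE 0F))    = refl
  decode-gEnds (acE (penE 0F))    = refl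
  decode-gEnds (cbE (cycE 0F))    = refl
  decode-gEnds (cbE (penE 0F))    = refl
  decode-gEnds (cwE _)            = refl
  decode-gEnds (w0E _)            = refl
  decode-gEnds (w1E _)            = refl
  decode-gEnds (kkE e i j i<j 2≤j) = kEdge-forward e i j i<j 2≤j

  decoded : ∀ {x p} → gEnds x ≡ p → x ≡ decode p
  decoded {x} eq = trans (sym (decode-gEnds x)) (cong decode eq)

  decode-swap : ∀ x → x ≢ acE cc → x ≢ cbE cc → decode (swap (gEnds x)) ≡ x
  decode-swap (acE (cycE 0F)) x≢ _ = ⊥-elim (x≢ refl)
  decode-swap (cbE (cycE 0F)) _ x≢ = ⊥-elim (x≢ refl)
  decode-swap (acE (penE 0F)) _ _  = refl
  decode-swap (cbE (penE 0F)) _ _  = refl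
  decode-swap (cwE _) _ _          = refl
  decode-swap (w0E _) _ _          = refl
  decode-swap (w1E _) _ _          = refl
  decode-swap (kkE e i j i<j 2≤j) _ _ = kEdge-backward e i j i<j 2≤j

  endpoints-determine : ∀ (x y : GE 1 (suc d)) → gEnds x ≡ gEnds y ⊎ gEnds x ≡ swap (gEnds y) →
                        x ≡ y ⊎ Parallel x y
  endpoints-determine x y (inj₁ eq) = inj₁ (trans (decoded eq) (decode-gEnds y))
  endpoints-determine x y@(acE (cycE 0F)) (inj₂ eq) = inj₂ (inj₂ (decoded eq , refl))
  endpoints-determine x y@(cbE (cycE 0F)) (inj₂ eq) = inj₂ (inj₁ (decoded eq , refl))
  endpoints-determine x y@(acE (penE 0F)) (inj₂ eq) = inj₁ (trans (decoded eq) (decode-swap y (λ ()) (λ ())))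
  endpoints-determine x y@(cbE (penE 0F)) (inj₂ eq) = inj₁ (trans (decoded eq) (decode-swap y (λ ()) (λ ())))
  endpoints-determine x y@(cwE _) (inj₂ eq) = inj₁ (trans (decoded eq) (decode-swap y (λ ()) (λ ())))
  endpoints-determine x y@(w0E _) (inj₂ eq) = inj₁ (trans (decoded eq) (decode-swap y (λ ()) (λ ())))
  endpoints-determine x y@(w1E _) (inj₂ eq) = inj₁ (trans (decoded eq) (decode-swap y (λ ()) (λ ())))
  endpoints-determine x y@(kkE _ _ _ _ _) (inj₂ eq) = inj₁ (trans (decoded eq) (decode-swap y (λ ()) (λ ())))

  nonParallel : ∀ (x y : GE 1 (suc d)) → x ≢ y → ¬ Parallel x y → NonParallel (gEnds x) (gEnds y)
  nonParallel x y x≢y ¬par u≢v u∈x v∈x u∈y v∈y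
    with endpoints-determine x y (same-points (gEnds x) (gEnds y) u≢v u∈x v∈x u∈y v∈y)
  ... | inj₁ x≡y = x≢y x≡y
  ... | inj₂ par = ¬par par

  edge-at-cyc : ∀ (y : GE 1 (suc d)) → sv (cyc 0F) ∈ₚ gEnds y → y ≡ acE cc ⊎ y ≡ cbE cc ⊎ y ≡ acE pp
  edge-at-cyc y s∈y with at-sunlet y s∈y
  ... | inj₁ (cycE 0F , refl , _) = inj₁ refl
  ... | inj₁ (penE 0F , refl , _) = inj₂ (inj₂ refl)
  ... | inj₂ (cycE 0F , refl , _) = inj₂ (inj₁ refl)
  ... | inj₂ (penE 0F , refl , ())

  edge-at-pen : ∀ (y : GE 1 (suc d)) → sv (pen 0F) ∈ₚ gEnds y → y ≡ cbE pp
  edge-at-pen y s∈y with at-sunlet y s∈y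
  ... | inj₁ (cycE 0F , _ , ())
  ... | inj₁ (penE 0F , _ , ())
  ... | inj₂ (cycE 0F , _ , ())
  ... | inj₂ (penE 0F , refl , _) = refl

  private
    triple : ∀ {A : Set} → A → A → A → Fin 3 → A
    triple a _ _ 0F = a
    triple _ b _ 1F = b
    triple _ _ c 2F = c

    in-triple : ∀ {A : Set} {x a b c : A} → x ≡ a ⊎ x ≡ b ⊎ x ≡ c → ∃ λ t → x ≡ triple a b c t
    in-triple (inj₁ x≡a)        = 0F , x≡a
    in-triple (inj₂ (inj₁ x≡b)) = 1F , x≡b
    in-triple (inj₂ (inj₂ x≡c)) = 2F , x≡c

  vertex-of-degree≥4⇒kv : ∀ {k v} (y : Fin (4 + k) → GE 1 (suc d)) → Injective _≡_ _≡_ y →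
                          (∀ a → v ∈ₚ gEnds (y a)) → ∃₂ λ b i → v ≡ kv b i
  vertex-of-degree≥4⇒kv {v = kv b i} _ _ _ = b , i , refl
  vertex-of-degree≥4⇒kv {v = sv (cyc 0F)} y y-inj v∈ with s≤s (s≤s (s≤s ())) ←
    injective-into-image⇒≤ y-inj (triple (acE cc) (cbE cc) (acE pp)) (in-triple ∘ λ a → edge-at-cyc (y a) (v∈ a))
  vertex-of-degree≥4⇒kv {v = sv (pen 0F)} y y-inj v∈ with s≤s () ←
    injective-into-image⇒≤ y-inj (λ (_ : Fin 1) → cbE pp) (λ a → 0F , edge-at-pen (y a) (v∈ a))
  vertex-of-degree≥4⇒kv {v = cv b} y y-inj v∈ with s≤s (s≤s (s≤s ())) ←
    injective-into-image⇒≤ y-inj (triple (acE b) (cbE b) (cwE b)) (in-triple ∘ λ a → edge-at-c {d = d} (y a) (v∈ a))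
  vertex-of-degree≥4⇒kv {v = wv b} y y-inj v∈ with s≤s (s≤s (s≤s ())) ←
    injective-into-image⇒≤ y-inj (triple (cwE b) (w0E b) (w1E b)) (in-triple ∘ λ a → edge-at-w {d = d} (y a) (v∈ a))

  Adjᵀ : GE 1 (suc d) → GE 1 (suc d) → Set
  Adjᵀ = Graph.Adj (L T)

  _≟ᵀ_ : DecidableEquality (GE 1 (suc d))
  x ≟ᵀ y = map′ (λ eq → trans (decoded eq) (decode-gEnds y)) (cong gEnds) (≡-dec _≟ᵥ_ _≟ᵥ_ (gEnds x) (gEnds y))

  Adjᵀ? : ∀ x y → Dec (Adjᵀ x y)
  Adjᵀ? x y = ¬? (x ≟ᵀ y) ×-dec shareEnd? (gEnds x) (gEnds y)

  private
    pair : ∀ {A : Set} → A → A → Fin 2 → A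
    pair a _ 0F = a
    pair _ b 1F = b

    acE-pp≁cwE-cc : ¬ shareEnd (gEnds (acE pp)) (gEnds (cwE {1} {suc d} cc))
    acE-pp≁cwE-cc (inj₁ ())
    acE-pp≁cwE-cc (inj₂ (inj₁ ()))
    acE-pp≁cwE-cc (inj₂ (inj₂ (inj₁ ())))
    acE-pp≁cwE-cc (inj₂ (inj₂ (inj₂ ())))

  module _ {k} (y : Fin (4 + k) → GE 1 (suc d)) (adj : ∀ a b → a ≢ b → Adjᵀ (y a) (y b)) where

    private
      -- Apart from the parallel pair itself, the edges at its two ends are acE pp and cwE cc.
      beside-parallel : ∀ {a b} t → y a ≡ acE cc → y b ≡ cbE cc → t ≢ a → t ≢ b →
                        y t ≡ acE pp ⊎ y t ≡ cwE cc
      beside-parallel {a} {b} t ya yb t≢a t≢b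
        with shareEnd⇒common (gEnds (y t)) (gEnds (acE cc))
               (subst (shareEnd (gEnds (y t)) ∘ gEnds) ya (proj₂ (adj t a t≢a)))
      ... | _ , v∈t , inj₁ refl with edge-at-cyc (y t) v∈t
      ...   | inj₁ yt≡ = ⊥-elim (proj₁ (adj t a t≢a) (trans yt≡ (sym ya)))
      ...   | inj₂ (inj₁ yt≡) = ⊥-elim (proj₁ (adj t b t≢b) (trans yt≡ (sym yb)))
      ...   | inj₂ (inj₂ yt≡) = inj₁ yt≡
      beside-parallel {a} {b} t ya yb t≢a t≢b | _ , v∈t , inj₂ refl with edge-at-c (y t) v∈t
      ...   | inj₁ yt≡ = ⊥-elim (proj₁ (adj t a t≢a) (trans yt≡ (sym ya)))
      ...   | inj₂ (inj₁ yt≡) = ⊥-elim (proj₁ (adj t b t≢b) (trans yt≡ (sym yb)))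
      ...   | inj₂ (inj₂ yt≡) = inj₂ yt≡

      no-parallel-pair : ∀ a b → y a ≡ acE cc → y b ≡ cbE cc → ⊥
      no-parallel-pair a b ya yb
        with avoid (pair a b) (s≤s (s≤s (s≤s z≤n)))
      ... | c , c-new with avoid (triple a b c) (s≤s (s≤s (s≤s (s≤s z≤n))))
      ... | c′ , c′-new
        with beside-parallel c ya yb (c-new 0F ∘ sym) (c-new 1F ∘ sym)
           | beside-parallel c′ ya yb (c′-new 0F ∘ sym) (c′-new 1F ∘ sym)
           | adj c c′ (c′-new 2F)
      ... | inj₁ yc | inj₁ yc′ | yc≢yc′ , _ = yc≢yc′ (trans yc (sym yc′))
      ... | inj₂ yc | inj₂ yc′ | yc≢yc′ , _ = yc≢yc′ (trans yc (sym yc′))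
      ... | inj₁ yc | inj₂ yc′ | _ , yc~yc′ = acE-pp≁cwE-cc (subst₂ (shareEnd on gEnds) yc yc′ yc~yc′)
      ... | inj₂ yc | inj₁ yc′ | _ , yc~yc′ =
        acE-pp≁cwE-cc (subst₂ (shareEnd on gEnds) yc′ yc (shareEnd-sym _ _ yc~yc′))

    clique-avoids-parallel : ∀ a b → ¬ Parallel (y a) (y b)
    clique-avoids-parallel a b (inj₁ (ya , yb)) = no-parallel-pair a b ya yb
    clique-avoids-parallel a b (inj₂ (ya , yb)) = no-parallel-pair b a yb ya

  meets-both-halves⇒special : ∀ {b} x → Adjᵀ x (w0E b) → Adjᵀ x (w1E b) → Special x
  meets-both-halves⇒special {b} x (x≢w0 , x~w0) (x≢w1 , x~w1) with wv b ∈ₚ? gEnds x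
  ... | yes w∈x with edge-at-w x w∈x
  ...   | inj₁ x≡cw        = b , x≡cw
  ...   | inj₂ (inj₁ x≡w0) = ⊥-elim (x≢w0 x≡w0)
  ...   | inj₂ (inj₂ x≡w1) = ⊥-elim (x≢w1 x≡w1)
  meets-both-halves⇒special {b} x (x≢w0 , x~w0) (x≢w1 , x~w1) | no w∉x
    with meets-away (gEnds (w0E b)) (gEnds x) (inj₁ refl) w∉x (shareEnd-sym _ _ x~w0)
       | meets-away (gEnds (w1E b)) (gEnds x) (inj₁ refl) w∉x (shareEnd-sym _ _ x~w1)
  ... | _ , o≢w , inj₁ refl , _ | _ = ⊥-elim (o≢w refl)
  ... | _ | _ , o≢w , inj₁ refl , _ = ⊥-elim (o≢w refl)
  ... | _ , _ , inj₂ refl , k₀∈x | _ , _ , inj₂ refl , k₁∈x with kv-pair⇒kEdge x k₀∈x k₁∈x (λ ())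
  ...   | _ , ¬sub , _ = ⊥-elim (¬sub (inj₁ (refl , refl)))

-- Dragons with d ≥ 4

module LargeDragon {n m : ℕ} (g : GE n (4 + m) → GE 1 (4 + m)) (g-hom : IsHom (L (G n (4 + m))) (L (G 1 (4 + m))) g)
                   (e : SE n) where

  open Target {3 + m}

  K : Set
  K = Fin (5 + m)

  star : K → Fin (4 + m) → GE 1 (4 + m)
  star i a = g (kEdge e i (punchIn i a))

  star-clique : ∀ i a b → a ≢ b → Adjᵀ (star i a) (star i b)
  star-clique i a b a≢b = g-hom (star-adjacent e i _ _ (Fin.punchInᵢ≢i i a ∘ sym) (Fin.punchInᵢ≢i i b ∘ sym)
                                                     (a≢b ∘ Fin.punchIn-injective i a b))

  star-injective : ∀ i → Injective _≡_ _≡_ (star i)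
  star-injective i {a} {b} eq with a Fin.≟ b
  ... | yes a≡b = a≡b
  ... | no a≢b  = ⊥-elim (proj₁ (star-clique i a b a≢b) eq)

  -- The edges at kᵢ form a clique of size d ≥ 4, so their images all pass through one K-vertex,
  -- the hub of i.
  abstract
    private
      star-centre : ∀ i → ∃ λ u → ∀ a → u ∈ₚ gEnds (star i a)
      star-centre i = pairwiseMeeting⇒common (gEnds ∘ star i) λ a b a≢b →
        proj₂ (star-clique i a b a≢b) ,
        nonParallel _ _ (proj₁ (star-clique i a b a≢b)) (clique-avoids-parallel (star i) (star-clique i) a b)

      star-centre-kv : ∀ i → ∃₂ λ b t → proj₁ (star-centre i) ≡ kv b t
      star-centre-kv i = vertex-of-degree≥4⇒kv (star i) (star-injective i) (proj₂ (star-centre i))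

    hubCopy : K → SE 1
    hubCopy i = proj₁ (star-centre-kv i)

    hubIndex : K → K
    hubIndex i = proj₁ (proj₂ (star-centre-kv i))

    hub-at : ∀ i j → i ≢ j → kv (hubCopy i) (hubIndex i) ∈ₚ gEnds (g (kEdge e i j))
    hub-at i j i≢j = subst₂ (λ u t → u ∈ₚ gEnds (g (kEdge e i t)))
                            (proj₂ (proj₂ (star-centre-kv i))) (Fin.punchIn-punchOut i≢j)
                            (proj₂ (star-centre i) (punchOut i≢j))

  hub : K → GV 1 (4 + m)
  hub i = kv (hubCopy i) (hubIndex i)

  hub-at′ : ∀ i j → i ≢ j → ¬ Subdivided i j → hub j ∈ₚ gEnds (g (kEdge e i j))
  hub-at′ i j i≢j ¬sub = from-other-end (λ y → hub j ∈ₚ gEnds (g y)) i j i≢j ¬sub (hub-at j i (i≢j ∘ sym))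

  -- Otherwise the distinct hubs of k and a would both lie on the images of the adjacent edges
  -- towards a and towards b at kₖ.
  spread : ∀ {a b k} → a ≢ b → hub a ≡ hub b → k ≢ a → k ≢ b → ¬ Subdivided k a → ¬ Subdivided k b →
           hub k ≡ hub a
  spread {a} {b} {k} a≢b same k≢a k≢b ¬sub-a ¬sub-b with hub k ≟ᵥ hub a
  ... | yes eq = eq
  ... | no distinct = ⊥-elim (proj₁ (g-hom (star-adjacent e k a b k≢a k≢b a≢b))
          (kv-pair-determines _ _ distinct (hub-at k a k≢a) (hub-at′ k a k≢a ¬sub-a) (hub-at k b k≢b)
                                           (subst (_∈ₚ gEnds (g (kEdge e k b))) (sym same) (hub-at′ k b k≢b ¬sub-b))))

  collapse : ∀ {a b} → a ≢ b → hub a ≡ hub b → ∀ k → hub k ≡ hub a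
  collapse {a} {b} a≢b same k = hub-k
    where
    forbidden : Fin 4 → K
    forbidden 0F = 0F
    forbidden 1F = 1F
    forbidden 2F = a
    forbidden 3F = b

    c : K
    c = proj₁ (avoid forbidden (s≤s (s≤s (s≤s (s≤s (s≤s z≤n))))))
    c-new : ∀ t → forbidden t ≢ c
    c-new = proj₂ (avoid forbidden (s≤s (s≤s (s≤s (s≤s (s≤s z≤n))))))

    ¬sub-c : ∀ {x} → ¬ Subdivided c x
    ¬sub-c = ¬Subdivided-away (c-new 0F ∘ sym) (c-new 1F ∘ sym)

    hub-c : hub c ≡ hub a
    hub-c = spread a≢b same (c-new 2F ∘ sym) (c-new 3F ∘ sym) ¬sub-c ¬sub-c

    via : ∀ x → hub x ≡ hub a → x ≢ c → k ≢ x → k ≢ c → ¬ Subdivided k x → hub k ≡ hub a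
    via x hub-x x≢c k≢x k≢c ¬sub =
      trans (spread x≢c (trans hub-x (sym hub-c)) k≢x k≢c ¬sub (¬sub-c ∘ Subdivided-sym)) hub-x

    hub-k : hub k ≡ hub a
    hub-k with k Fin.≟ c | k Fin.≟ a | Subdivided? k a | k Fin.≟ b
    ... | yes k≡c | _ | _ | _ = trans (cong hub k≡c) hub-c
    ... | no _ | yes refl | _ | _ = refl
    ... | no k≢c | no k≢a | no ¬sub | _ = via a refl (c-new 2F) k≢a k≢c ¬sub
    ... | no _ | no _ | yes _ | yes refl = sym same
    ... | no k≢c | no _ | yes sub | no k≢b = via b (sym same) (c-new 3F) k≢b k≢c (a≢b ∘ Subdivided-functional sub)

  -- If two hubs coincide, all edges of the dragon map to edges at one K-vertex kv B₀ c₀ of the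
  -- target, and their other ends colour the dragon with the d indices other than c₀.
  collapsed-colouring : ∀ {a b} → a ≢ b → hub a ≡ hub b → DragonColouring (3 + m)
  collapsed-colouring {a} {b} a≢b same = record
    { excluded         = c₀
    ; colour           = colour
    ; colour≢excluded  = λ i j i≢j → proj₁ (colour-spec i j i≢j) ∘ sym
    ; colour-injective = colour-injective
    ; colour-sym       = colour-sym
    ; colour-halves    = colour-halves
    }
    where
    B₀  = hubCopy a
    c₀ = hubIndex a

    far-end : ∀ i j → i ≢ j → ∃ λ t → c₀ ≢ t × g (kEdge e i j) ≡ kEdge B₀ c₀ t
    far-end i j i≢j =
      edge-at-kv (g (kEdge e i j)) (subst (_∈ₚ gEnds (g (kEdge e i j))) (collapse a≢b same i) (hub-at i j i≢j))

    colourDec : ∀ i j → Dec (i ≡ j) → K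
    colourDec i j (yes _)   = c₀
    colourDec i j (no i≢j)  = proj₁ (far-end i j i≢j)

    colourDec-spec : ∀ i j (i≟j : Dec (i ≡ j)) → i ≢ j →
                     c₀ ≢ colourDec i j i≟j × g (kEdge e i j) ≡ kEdge B₀ c₀ (colourDec i j i≟j)
    colourDec-spec i j (yes i≡j) i≢j = ⊥-elim (i≢j i≡j)
    colourDec-spec i j (no i≢j)  _   = proj₂ (far-end i j i≢j)

    colour : K → K → K
    colour i j = colourDec i j (i Fin.≟ j)

    colour-spec : ∀ i j → i ≢ j → c₀ ≢ colour i j × g (kEdge e i j) ≡ kEdge B₀ c₀ (colour i j)
    colour-spec i j = colourDec-spec i j (i Fin.≟ j)

    image : ∀ i j → i ≢ j → g (kEdge e i j) ≡ kEdge B₀ c₀ (colour i j)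
    image i j i≢j = proj₂ (colour-spec i j i≢j)

    colour-injective : ∀ i j j′ → i ≢ j → i ≢ j′ → colour i j ≡ colour i j′ → j ≡ j′
    colour-injective i j j′ i≢j i≢j′ eq with j Fin.≟ j′
    ... | yes j≡j′ = j≡j′
    ... | no j≢j′  = ⊥-elim (proj₁ (g-hom (star-adjacent e i j j′ i≢j i≢j′ j≢j′))
                                   (trans (image i j i≢j) (trans (cong (kEdge B₀ c₀) eq) (sym (image i j′ i≢j′)))))

    colour-sym : ∀ i j → i ≢ j → ¬ Subdivided i j → colour i j ≡ colour j i
    colour-sym i j i≢j ¬sub =
      kEdge-injective B₀ c₀ _ _ (proj₁ (colour-spec i j i≢j)) (proj₁ (colour-spec j i (i≢j ∘ sym))) (begin
      kEdge B₀ c₀ (colour i j)  ≡⟨ image i j i≢j ⟨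
      g (kEdge e i j)           ≡⟨ cong g (kEdge-sym e i j i≢j ¬sub) ⟩
      g (kEdge e j i)           ≡⟨ image j i (i≢j ∘ sym) ⟩
      kEdge B₀ c₀ (colour j i)  ∎)

    colour-halves : colour 0F 1F ≢ colour 1F 0F
    colour-halves eq = proj₁ (g-hom w0~w1)
      (trans (image 0F 1F (λ ())) (trans (cong (kEdge B₀ c₀) eq) (sym (image 1F 0F (λ ())))))

  hub-injective : ∀ a b → a ≢ b → hub a ≢ hub b
  hub-injective a b a≢b same = ¬DragonColouring (collapsed-colouring a≢b same)

  B : SE 1
  B = hubCopy 2F

  hubCopy-constant : ∀ i → hubCopy i ≡ B
  hubCopy-constant i with i Fin.≟ 2F
  ... | yes refl = refl
  ... | no i≢2 = proj₁ (kv-pair⇒kEdge (g (kEdge e 2F i)) (hub-at 2F i (i≢2 ∘ sym))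
                                      (hub-at′ 2F i (i≢2 ∘ sym) (¬Subdivided-away (λ ()) (λ ())))
                                      (hub-injective 2F i (i≢2 ∘ sym)))

  hubIndex-injective : Injective _≡_ _≡_ hubIndex
  hubIndex-injective {a} {b} eq with a Fin.≟ b
  ... | yes a≡b = a≡b
  ... | no a≢b  = ⊥-elim (hub-injective a b a≢b (cong₂ kv (trans (hubCopy-constant a) (sym (hubCopy-constant b))) eq))

  at-B : ∀ i j → i ≢ j → kv B (hubIndex i) ∈ₚ gEnds (g (kEdge e i j))
  at-B i j i≢j = subst (λ b → kv b (hubIndex i) ∈ₚ gEnds (g (kEdge e i j))) (hubCopy-constant i) (hub-at i j i≢j)

  image-of-full-edge : ∀ i j → i ≢ j → ¬ Subdivided i j →
                       ¬ Subdivided (hubIndex i) (hubIndex j) × g (kEdge e i j) ≡ kEdge B (hubIndex i) (hubIndex j)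
  image-of-full-edge i j i≢j ¬sub =
    proj₂ (kv-pair⇒kEdge (g (kEdge e i j)) (at-B i j i≢j)
                         (from-other-end (λ y → kv B (hubIndex j) ∈ₚ gEnds (g y)) i j i≢j ¬sub (at-B j i (i≢j ∘ sym)))
                         (i≢j ∘ hubIndex-injective ∘ proj₂ ∘ kv-injective))

  -- Any far end other than hubIndex j would be shared with the image of an edge kᵢkⱼ′ adjacent
  -- to kEdge e i j.
  image-of-half : ∀ i j → Subdivided i j → g (kEdge e i j) ≡ kEdge B (hubIndex i) (hubIndex j)
  image-of-half i j sub with edge-at-kv (g (kEdge e i j)) (at-B i j (Subdivided⇒≢ sub))
  ... | t , ιi≢t , image with injective⇒surjective hubIndex-injective t
  ...   | j′ , refl with j′ Fin.≟ j
  ...     | yes refl = image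
  ...     | no j′≢j  = ⊥-elim (proj₁ (g-hom (star-adjacent e i j′ j i≢j′ (Subdivided⇒≢ sub) j′≢j))
                         (trans (proj₂ (image-of-full-edge i j′ i≢j′ (j′≢j ∘ sym ∘ Subdivided-functional sub)))
                                (sym image)))
    where
    i≢j′ : i ≢ j′
    i≢j′ refl = ιi≢t refl

  halves-to-halves : Subdivided (hubIndex 0F) (hubIndex 1F)
  halves-to-halves with injective⇒surjective hubIndex-injective 0F | injective⇒surjective hubIndex-injective 1F
  ... | i₀ , ιi₀≡0 | i₁ , ιi₁≡1 with Subdivided? i₀ i₁
  ...   | yes (inj₁ (refl , refl)) = inj₁ (ιi₀≡0 , ιi₁≡1)
  ...   | yes (inj₂ (refl , refl)) = inj₂ (ιi₁≡1 , ιi₀≡0)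
  ...   | no ¬sub = ⊥-elim (proj₁ (image-of-full-edge i₀ i₁ i₀≢i₁ ¬sub) (inj₁ (ιi₀≡0 , ιi₁≡1)))
    where
    i₀≢i₁ : i₀ ≢ i₁
    i₀≢i₁ refl = Fin.0≢1+n (trans (sym ιi₀≡0) ιi₁≡1)

  private
    image₀ : g (w0E e) ≡ kEdge B (hubIndex 0F) (hubIndex 1F)
    image₀ = image-of-half 0F 1F (inj₁ (refl , refl))

    image₁ : g (w1E e) ≡ kEdge B (hubIndex 1F) (hubIndex 0F)
    image₁ = image-of-half 1F 0F (inj₂ (refl , refl))

    cw-meets : ∀ {y z} → Graph.Adj (L (G n (4 + m))) (cwE e) y → g y ≡ z → Adjᵀ (g (cwE e)) z
    cw-meets adj eq = subst (Adjᵀ (g (cwE e))) eq (g-hom adj)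

  halves-map-to-halves : g (w0E e) ≡ w0E B × g (w1E e) ≡ w1E B ⊎ g (w0E e) ≡ w1E B × g (w1E e) ≡ w0E B
  halves-map-to-halves with halves-to-halves
  ... | inj₁ (ι0≡0 , ι1≡1) =
    inj₁ (trans image₀ (cong₂ (kEdge B) ι0≡0 ι1≡1) , trans image₁ (cong₂ (kEdge B) ι1≡1 ι0≡0))
  ... | inj₂ (ι0≡1 , ι1≡0) =
    inj₂ (trans image₀ (cong₂ (kEdge B) ι0≡1 ι1≡0) , trans image₁ (cong₂ (kEdge B) ι1≡0 ι0≡1))

  large-dragon : Special (g (cwE e))
  large-dragon with halves-map-to-halves
  ... | inj₁ (g-w0 , g-w1) = meets-both-halves⇒special _ (cw-meets cw~w0 g-w0) (cw-meets cw~w1 g-w1)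
  ... | inj₂ (g-w0 , g-w1) = meets-both-halves⇒special _ (cw-meets cw~w1 g-w1) (cw-meets cw~w0 g-w0)

-- The dragon with d = 3

module _ {n d : ℕ} where

  ∀-SE? : ∀ {P : SE n → Set} → Decidable P → Dec (∀ e → P e)
  ∀-SE? P? = map′ (λ (onCyc , onPen) → λ { (cycE i) → onCyc i ; (penE i) → onPen i })
                  (λ all → all ∘ cycE , all ∘ penE)
                  (Fin.all? (P? ∘ cycE) ×-dec Fin.all? (P? ∘ penE))

  ∀-GE? : ∀ {P : GE n (suc d) → Set} → Decidable P → Dec (∀ x → P x)
  ∀-GE? {P} P? =
    map′ combine
      (λ all → all ∘ acE , all ∘ cbE , all ∘ cwE , all ∘ w0E , all ∘ w1E , λ e i j i<j 2≤j → all (kkE e i j i<j 2≤j))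
      (∀-SE? (P? ∘ acE) ×-dec ∀-SE? (P? ∘ cbE) ×-dec ∀-SE? (P? ∘ cwE) ×-dec ∀-SE? (P? ∘ w0E) ×-dec
       ∀-SE? (P? ∘ w1E) ×-dec
       ∀-SE? λ e → Fin.all? λ i → Fin.all? λ j → ∀-kk? e i j (toℕ i ℕ.<? toℕ j) (2 ℕ.≤? toℕ j))
    where
    ∀-kk? : ∀ e i j → Dec (toℕ i < toℕ j) → Dec (2 ≤ toℕ j) → Dec (∀ i<j 2≤j → P (kkE e i j i<j 2≤j))
    ∀-kk? e i j (yes i<j) (yes 2≤j) =
      map′ (λ p _ _ → subst P kkE-irrelevant p) (λ all → all i<j 2≤j) (P? (kkE e i j i<j 2≤j))
    ∀-kk? e i j (no i≮j)  _         = yes λ i<j → ⊥-elim (i≮j i<j)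
    ∀-kk? e i j _         (no 2≰j)  = yes λ _ 2≤j → ⊥-elim (2≰j 2≤j)
    combine : _ → ∀ x → P x
    combine (ac , cb , cw , w0 , w1 , kk) (acE e) = ac e
    combine (ac , cb , cw , w0 , w1 , kk) (cbE e) = cb e
    combine (ac , cb , cw , w0 , w1 , kk) (cwE e) = cw e
    combine (ac , cb , cw , w0 , w1 , kk) (w0E e) = w0 e
    combine (ac , cb , cw , w0 , w1 , kk) (w1E e) = w1 e
    combine (ac , cb , cw , w0 , w1 , kk) (kkE e i j i<j 2≤j) = kk e i j i<j 2≤j

module SmallDragon where
  open Target {2}

  -- tC is not the image of cw under any homomorphism from the line graph of D₃ plus the edge cw:
  -- the other variables are the images of w0, w1, k₀k₂, k₀k₃, k₂k₃, k₁k₂, k₁k₃, and the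
  -- hypotheses are the 15 adjacencies among these eight edges.
  NoExtension : GE 1 3 → Set
  NoExtension tC =
    ∀ tW0 → Adjᵀ tC tW0 →
    ∀ tW1 → Adjᵀ tC tW1 → Adjᵀ tW0 tW1 →
    ∀ t02 → Adjᵀ tW0 t02 →
    ∀ t03 → Adjᵀ tW0 t03 → Adjᵀ t02 t03 →
    ∀ t23 → Adjᵀ t02 t23 → Adjᵀ t03 t23 →
    ∀ t12 → Adjᵀ tW1 t12 → Adjᵀ t02 t12 → Adjᵀ t23 t12 →
    ∀ t13 → Adjᵀ tW1 t13 → Adjᵀ t12 t13 → Adjᵀ t03 t13 → Adjᵀ t23 t13 → ⊥

  noExtension? : ∀ tC → Dec (NoExtension tC)
  noExtension? tC =
    ∀-GE? λ tW0 → Adjᵀ? tC tW0 →-dec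
    ∀-GE? λ tW1 → Adjᵀ? tC tW1 →-dec Adjᵀ? tW0 tW1 →-dec
    ∀-GE? λ t02 → Adjᵀ? tW0 t02 →-dec
    ∀-GE? λ t03 → Adjᵀ? tW0 t03 →-dec Adjᵀ? t02 t03 →-dec
    ∀-GE? λ t23 → Adjᵀ? t02 t23 →-dec Adjᵀ? t03 t23 →-dec
    ∀-GE? λ t12 → Adjᵀ? tW1 t12 →-dec Adjᵀ? t02 t12 →-dec Adjᵀ? t23 t12 →-dec
    ∀-GE? λ t13 → Adjᵀ? tW1 t13 →-dec Adjᵀ? t12 t13 →-dec Adjᵀ? t03 t13 →-dec ¬? (Adjᵀ? t23 t13)

  special? : ∀ (x : GE 1 3) → Dec (Special x)
  special? (cwE e)         = yes (e , refl)
  special? (acE _)         = no λ ()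
  special? (cbE _)         = no λ ()
  special? (w0E _)         = no λ ()
  special? (w1E _)         = no λ ()
  special? (kkE _ _ _ _ _) = no λ ()

  -- An exhaustive search through the 20 edges of G_{1,3}.
  abstract
    special-or-unextendable : ∀ tC → Special tC ⊎ NoExtension tC
    special-or-unextendable = from-yes (∀-GE? λ tC → special? tC ⊎-dec noExtension? tC)

  small-dragon : ∀ {n} (g : GE n 3 → GE 1 3) → IsHom (L (G n 3)) (L (G 1 3)) g → ∀ e → Special (g (cwE e))
  small-dragon g g-hom e with special-or-unextendable (g (cwE e))
  ... | inj₁ special = special
  ... | inj₂ none = ⊥-elim (none
    _ (g-hom cw~w0)
    _ (g-hom cw~w1) (g-hom w0~w1)
    _ (at 0F 1F 2F)
    _ (at 0F 1F 3F) (at 0F 2F 3F)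
    _ (at 2F 0F 3F) (at 3F 0F 2F)
    _ (at 1F 0F 2F) (at 2F 0F 1F) (at 2F 3F 1F)
    _ (at 1F 0F 3F) (at 1F 2F 3F) (at 3F 0F 1F) (at 3F 2F 1F))
    where
    at : ∀ i j j′ {i≢j : False (i Fin.≟ j)} {i≢j′ : False (i Fin.≟ j′)} {j≢j′ : False (j Fin.≟ j′)} →
         Adjᵀ (g (kEdge e i j)) (g (kEdge e i j′))
    at i j j′ {i≢j} {i≢j′} {j≢j′} =
      g-hom (star-adjacent e i j j′ (toWitnessFalse i≢j) (toWitnessFalse i≢j′) (toWitnessFalse j≢j′))

dragon-special : ∀ {n d} → 3 ≤ suc d → (g : GE n (suc d) → GE 1 (suc d)) →
                 IsHom (L (G n (suc d))) (L (G 1 (suc d))) g → ∀ e → Special (g (cwE e))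
dragon-special {d = 2}                 _ = SmallDragon.small-dragon
dragon-special {d = suc (suc (suc m))} _ = LargeDragon.large-dragon
dragon-special {d = 0} (s≤s ())
dragon-special {d = 1} (s≤s (s≤s ()))

lemma13 : (d n n' : ℕ) → 3 ≤ d → 3 ≤ n → 3 ≤ n' →
          (f : GE n d → GE n' d) → IsHom (L (G n d)) (L (G n' d)) f →
          (x : GE n d) → Special x → Special (f x)
lemma13 (suc d) n n' 3≤d _ _ f f-hom .(cwE e) (e , refl) =
  fold-reflects-special (f (cwE e)) (dragon-special 3≤d (fold ∘ f) (λ adj → fold-hom (f-hom adj)) e)
  where open Fold {n'} {d}
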